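{- Let $A$ be a finite alphabet with $|A| = a \ge 2$, let $n$ be a positive integer and $k$ an integer with $2 \le k \le n/2$. There does not exist a universal partial word for $A^n$ of the form $w = \diamond^k v$, where $v$ is a word over $A$ (containing no $\diamond$).
   Context: A partial word over $A$ is a finite sequence of characters from $A \cup \{\diamond\}$, where $\diamond \notin A$ is a wild-card symbol; a word over $A$ contains no $\diamond$. $A^n$ denotes the set of words of length $n$ over $A$. For $x = x_1\cdots x_n \in A^n$ and a partial word $w = w_1\cdots w_N$, the position $i$ ($0 \le i \le N-n$) covers $x$ if $x_j = w_{i+j}$ for every $1\le j\le n$ with $w_{i+j}\in A$. A universal partial word for $A^n$ is a partial word $w$ such that every word in $A^n$ is covered by exactly one position of $w$. $\diamond^k$ denotes $k$ consecutive $\diamond$'s. -}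

module Defs where

open import Data.Nat using (ℕ; zero; suc; _+_; _≤_; _<_)
open import Data.Fin using (Fin; toℕ)
open import Data.Unit using (⊤)
open import Data.Empty using (⊥)
open import Data.Maybe using (Maybe; just; nothing)
open import Data.List using (List; length; replicate; map; _++_)
open import Data.Vec using (Vec; lookup)
open import Data.Product using (Σ; _×_)
open import Relation.Binary.PropositionalEquality using (_≡_)

-- The alphabet A with |A| = a is represented by Fin a.
-- A partial word over A: a list of letters from A ∪ {◇}, where
-- nothing plays the role of the hole ◇ and just x is the letter x.
PartialWord : ℕ → Set
PartialWord a = List (Maybe (Fin a))

Word : ℕ → ℕ → Set
Word a n = Vec (Fin a) n

-- i-th symbol (0-based) of a list; nothing if out of range (not used
-- in range-violating ways, since covering requires i + n ≤ length w).
_!_ : ∀ {X : Set} → List X → ℕ → Maybe X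
List.[] ! _ = nothing
(x List.∷ xs) ! zero = just x
(x List.∷ xs) ! suc i = xs ! i

Compatible : ∀ {a} → Maybe (Maybe (Fin a)) → Fin a → Set
Compatible (just nothing) c = ⊤
Compatible (just (just d)) c = d ≡ c
Compatible nothing c = ⊥

-- Position i (0-based, 0 ≤ i ≤ N - n) of w covers x ∈ A^n.
-- With 1-based x_j, w_{i+j}: x_j = w_{i+j} for every non-hole w_{i+j}.
Covers : ∀ {a n} → PartialWord a → ℕ → Word a n → Set
Covers {a} {n} w i x =
  (i + n ≤ length w) × ((j : Fin n) → Compatible (w ! (i + toℕ j)) (lookup x j))

Universal : ∀ {a} → (n : ℕ) → PartialWord a → Set
Universal {a} n w =
  (x : Word a n) →
    Σ ℕ (λ i → Covers w i x × ((i′ : ℕ) → Covers w i′ x → i′ ≡ i))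

holesThen : ∀ {a} → ℕ → List (Fin a) → PartialWord a
holesThen k v = replicate k nothing ++ map just v

module Submission where

-- Let w have holes at positions 0 and 1 and no holes from position n − 2 on, as ◇^k v does
-- when 2 ≤ k ≤ n − 2. For a hole at i, take the probe x read from w at position i + 1 with its
-- last letter replaced by f. If x is covered at p + 1, then x shifted right by one letter is
-- covered at p and, thanks to the hole, also at i; so x is covered at 0, or at i + 1, the latter
-- only if w_{i+n} = f. Choosing f ≠ w_{i+n} for i = 0, 1, both probes are covered at 0, which
-- gives w_{n−2} = w_{n−1} = f₀ and w_{n−2} = w_n, contradicting f₀ ≠ w_n. When w is too short
-- for the second probe, a constant word avoiding w_{n−1} is not covered at all.

open import Defs
open import Data.Nat using (ℕ; _≤_; _*_)
open import Data.Fin using (Fin)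
open import Data.List using (List)
open import Relation.Nullary using (¬_)

open import Function using (_∘_; const)
open import Data.Nat using (zero; suc; _+_; _<_; z≤n; s≤s; _<?_)
open import Data.Nat.Properties
  using (≤-refl; ≤-trans; n≤1+n; n<1+n; n≮n; m≤n+m; m≤m+n; m+n≤o⇒m≤o; ≮⇒≥; n≤0⇒n≡0;
         +-suc; +-identityʳ; +-cancelʳ-≤; +-monoˡ-≤; +-monoʳ-≤; +-monoʳ-<)
open import Data.Fin using (toℕ; fromℕ<) renaming (zero to fzero; suc to fsuc)
open import Data.Fin.Properties using (toℕ-fromℕ<; toℕ<n)
open import Data.List using ([]; _∷_; length)
open import Data.Maybe using (Maybe; just; nothing)
open import Data.Vec using (tabulate)
open import Data.Vec.Properties using (lookup∘tabulate)
open import Data.Product using (_×_; _,_; proj₁)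
open import Data.Sum using (_⊎_; inj₁; inj₂)
open import Data.Unit using (tt)
open import Data.Empty using (⊥-elim)
open import Relation.Nullary using (yes; no)
open import Relation.Binary.PropositionalEquality
  using (_≡_; _≢_; refl; sym; trans; cong; subst; module ≡-Reasoning)

word : ∀ {a} n → (ℕ → Fin a) → Word a n
word n X = tabulate (X ∘ toℕ)

cons : ∀ {a} → Fin a → (ℕ → Fin a) → ℕ → Fin a
cons b X zero = b
cons b X (suc j) = X j

HoleFreeFrom : ∀ {a} → ℕ → PartialWord a → Set
HoleFreeFrom i w = ∀ {j} → i ≤ j → w ! j ≢ just nothing

fill : ∀ {a} → Fin a → Maybe (Maybe (Fin a)) → Fin a
fill d (just (just c)) = c
fill d _ = d

compatible-fill : ∀ {a} d (w : PartialWord a) {j} → j < length w →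
  Compatible (w ! j) (fill d (w ! j))
compatible-fill d (nothing ∷ w) {zero} _ = tt
compatible-fill d (just c ∷ w) {zero} _ = refl
compatible-fill d (_ ∷ w) {suc j} (s≤s j<len) = compatible-fill d w j<len

compatible⇒fill≡ : ∀ {a} d {s : Maybe (Maybe (Fin a))} {c} →
  s ≢ just nothing → Compatible s c → fill d s ≡ c
compatible⇒fill≡ d {just (just _)} _ refl = refl
compatible⇒fill≡ d {just nothing} notHole _ = ⊥-elim (notHole refl)

avoid : ∀ {a} → Maybe (Maybe (Fin (suc (suc a)))) → Fin (suc (suc a))
avoid (just (just fzero)) = fsuc fzero
avoid _ = fzero

avoid-incompatible : ∀ {a} (s : Maybe (Maybe (Fin (suc (suc a))))) →
  s ≢ just nothing → ¬ Compatible s (avoid s)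
avoid-incompatible (just nothing) notHole _ = notHole refl
avoid-incompatible (just (just fzero)) _ ()
avoid-incompatible (just (just (fsuc _))) _ ()

module _ {a : ℕ} (w : PartialWord a) where

  Matches : ℕ → ℕ → (ℕ → Fin a) → Set
  Matches p n X = ∀ {j} → j < n → Compatible (w ! (p + j)) (X j)

  covers-word : ∀ {n p} X → p + n ≤ length w → Matches p n X → Covers w p (word n X)
  covers-word X len matches =
    len , λ j → subst (Compatible _) (sym (lookup∘tabulate (X ∘ toℕ) j)) (matches (toℕ<n j))

  covers-word⇒matches : ∀ {n p} X → Covers w p (word n X) → Matches p n X
  covers-word⇒matches {p = p} X (_ , c) {j} j<n =
    subst (λ i → Compatible (w ! (p + i)) (X i)) (toℕ-fromℕ< j<n)
      (subst (Compatible _) (lookup∘tabulate (X ∘ toℕ) (fromℕ< j<n)) (c (fromℕ< j<n)))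

  universal⇒unique-position : ∀ {n p q} → Universal n w →
    (x : Word a n) → Covers w p x → Covers w q x → p ≡ q
  universal⇒unique-position U x cp cq with U x
  ... | _ , _ , unique = trans (unique _ cp) (sym (unique _ cq))

  covers-suc⇒covers-cons : ∀ {n p} X d → Covers w (suc p) (word (suc n) X) →
    Covers w p (word (suc n) (cons (fill d (w ! p)) X))
  covers-suc⇒covers-cons {n} {p} X d cov@(len , _) =
    covers-word (cons (fill d (w ! p)) X) (≤-trans (n≤1+n _) len) matches
    where
      matches : Matches p (suc n) (cons (fill d (w ! p)) X)
      matches {zero} _ = subst (λ i → Compatible (w ! i) (fill d (w ! p))) (sym (+-identityʳ p))
                           (compatible-fill d w (m+n≤o⇒m≤o (suc p) len))
      matches {suc j} (s≤s j<n) = subst (λ i → Compatible (w ! i) (X j)) (sym (+-suc p j))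
                                    (covers-word⇒matches X cov (≤-trans j<n (n≤1+n n)))

  probe : (s n : ℕ) → Fin a → ℕ → Fin a
  probe s n f j with j <? n
  ... | yes _ = fill f (w ! (s + j))
  ... | no _ = f

  probe-< : ∀ s {n} f {j} → j < n → probe s n f j ≡ fill f (w ! (s + j))
  probe-< s {n} f {j} j<n with j <? n
  ... | yes _ = refl
  ... | no j≮n = ⊥-elim (j≮n j<n)

  probe-last : ∀ s n f → probe s n f n ≡ f
  probe-last s n f with n <? n
  ... | yes n<n = ⊥-elim (n≮n n n<n)
  ... | no _ = refl

  hole⇒covers-cons-probe : ∀ {n i} b f → w ! i ≡ just nothing → i + suc n ≤ length w →
    Covers w i (word (suc n) (cons b (probe (suc i) n f)))
  hole⇒covers-cons-probe {n} {i} b f hole len = covers-word (cons b (probe (suc i) n f)) len matches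
    where
      matches : Matches i (suc n) (cons b (probe (suc i) n f))
      matches {zero} _ =
        subst (λ s → Compatible s b) (sym (trans (cong (w !_) (+-identityʳ i)) hole)) tt
      matches {suc j} (s≤s j<n) =
        subst (λ k → Compatible (w ! k) (probe (suc i) n f j)) (sym (+-suc i j))
          (subst (Compatible (w ! suc (i + j))) (sym (probe-< (suc i) f j<n))
            (compatible-fill f w
              (≤-trans (subst (suc (i + j) <_) (sym (+-suc i n)) (s≤s (+-monoʳ-< i j<n))) len)))

  probe-dichotomy : ∀ {n i} → Universal (suc n) w →
    w ! i ≡ just nothing → i + suc n ≤ length w → ∀ f →
    Covers w 0 (word (suc n) (probe (suc i) n f)) ⊎ Compatible (w ! (suc i + n)) f
  probe-dichotomy {n} {i} U hole len f with U (word (suc n) (probe (suc i) n f))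
  ... | zero , cov , _ = inj₁ cov
  ... | suc p , cov , _ =
    inj₂ (subst (λ q → Compatible (w ! (suc q + n)) f) p≡i
           (subst (Compatible _) (probe-last (suc i) n f)
             (covers-word⇒matches (probe (suc i) n f) cov (n<1+n n))))
    where
      shifted : ℕ → Fin a
      shifted = cons (fill f (w ! p)) (probe (suc i) n f)
      p≡i : p ≡ i
      p≡i = universal⇒unique-position U (word (suc n) shifted)
              (covers-suc⇒covers-cons (probe (suc i) n f) f cov)
              (hole⇒covers-cons-probe (fill f (w ! p)) f hole len)

  probe-at-start : ∀ {n s f} → Covers w 0 (word (suc (suc n)) (probe s (suc n) f)) →
    Compatible (w ! n) (fill f (w ! (s + n))) × Compatible (w ! suc n) f
  probe-at-start {n} {s} {f} cov =
    subst (Compatible (w ! n)) (probe-< s f (n<1+n n)) (matches (m≤n+m (suc n) 1)) ,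
    subst (Compatible (w ! suc n)) (probe-last s (suc n) f) (matches (n<1+n (suc n)))
    where
      matches : Matches 0 (suc (suc n)) (probe s (suc n) f)
      matches = covers-word⇒matches (probe s (suc n) f) cov

long-leadingHoles-not-universal : ∀ {a n} (w : PartialWord (suc (suc a))) →
  w ! 0 ≡ just nothing → w ! 1 ≡ just nothing → HoleFreeFrom n w →
  suc (suc n) < length w → ¬ Universal (suc (suc n)) w
long-leadingHoles-not-universal {n = n} w hole₀ hole₁ letters long U
  with probe-dichotomy w U hole₀ (≤-trans (n≤1+n _) long) (avoid (w ! suc (suc n)))
     | probe-dichotomy w U hole₁ long (avoid (w ! suc (suc (suc n))))
... | inj₂ c | _ = avoid-incompatible _ (letters (m≤n+m n 2)) c
... | _ | inj₂ c = avoid-incompatible _ (letters (m≤n+m n 3)) c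
... | inj₁ cov₀ | inj₁ cov₁ with probe-at-start w cov₀ | probe-at-start w cov₁
... | penult₀ , last₀ | penult₁ , _ =
  avoid-incompatible _ (letters (m≤n+m n 2)) (subst (Compatible _) (sym f₀≡) (compatible-fill f₁ w long))
  where
    open ≡-Reasoning
    f₀ f₁ : Fin _
    f₀ = avoid (w ! suc (suc n))
    f₁ = avoid (w ! suc (suc (suc n)))
    f₀≡ : f₀ ≡ fill f₁ (w ! suc (suc n))
    f₀≡ = begin
      f₀                        ≡⟨ sym (compatible⇒fill≡ f₀ (letters (n≤1+n n)) last₀) ⟩
      fill f₀ (w ! suc n)       ≡⟨ sym (compatible⇒fill≡ f₀ (letters ≤-refl) penult₀) ⟩
      fill f₀ (w ! n)           ≡⟨ compatible⇒fill≡ f₀ (letters ≤-refl) penult₁ ⟩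
      fill f₁ (w ! suc (suc n)) ∎

short-not-universal : ∀ {a n} (w : PartialWord (suc (suc a))) →
  length w ≤ suc n → w ! n ≢ just nothing → ¬ Universal (suc n) w
short-not-universal {n = n} w short letter U with U (word (suc n) (const (avoid (w ! n))))
... | p , cov , _ =
  avoid-incompatible (w ! n) letter
    (subst (λ q → Compatible (w ! (q + n)) (avoid (w ! n))) p≡0
      (covers-word⇒matches w (const (avoid (w ! n))) cov (n<1+n n)))
  where
    p≡0 : p ≡ 0
    p≡0 = n≤0⇒n≡0 (+-cancelʳ-≤ (suc n) p 0 (≤-trans (proj₁ cov) short))

leadingHoles-not-universal : ∀ {a n} (w : PartialWord (suc (suc a))) →
  w ! 0 ≡ just nothing → w ! 1 ≡ just nothing → HoleFreeFrom n w → ¬ Universal (suc (suc n)) w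
leadingHoles-not-universal {n = n} w hole₀ hole₁ letters with suc (suc n) <? length w
... | yes long = long-leadingHoles-not-universal w hole₀ hole₁ letters long
... | no ¬long = short-not-universal w (≮⇒≥ ¬long) (letters (n≤1+n n))

holesThen-hole : ∀ {a} k (v : List (Fin a)) {j} → j < k → holesThen k v ! j ≡ just nothing
holesThen-hole (suc k) v {zero} _ = refl
holesThen-hole (suc k) v {suc j} (s≤s j<k) = holesThen-hole k v j<k

holesThen-holeFreeFrom : ∀ {a} k (v : List (Fin a)) → HoleFreeFrom k (holesThen k v)
holesThen-holeFreeFrom zero [] _ ()
holesThen-holeFreeFrom zero (c ∷ v) {zero} _ ()
holesThen-holeFreeFrom zero (c ∷ v) {suc j} _ = holesThen-holeFreeFrom zero v z≤n
holesThen-holeFreeFrom (suc k) v {suc j} (s≤s k≤j) = holesThen-holeFreeFrom k v k≤j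

holesThen-not-universal : ∀ {a k n} (v : List (Fin (suc (suc a)))) →
  2 ≤ k → 2 + k ≤ n → ¬ Universal n (holesThen k v)
holesThen-not-universal {k = k} v 2≤k (s≤s (s≤s k≤n)) =
  leadingHoles-not-universal (holesThen k v)
    (holesThen-hole k v (≤-trans (s≤s z≤n) 2≤k)) (holesThen-hole k v 2≤k)
    (λ n≤j → holesThen-holeFreeFrom k v (≤-trans k≤n n≤j))

2≤k⇒2*k≤n⇒2+k≤n : ∀ {k n} → 2 ≤ k → 2 * k ≤ n → 2 + k ≤ n
2≤k⇒2*k≤n⇒2+k≤n {k} 2≤k 2k≤n = ≤-trans (+-monoˡ-≤ k 2≤k) (≤-trans (+-monoʳ-≤ k (m≤m+n k 0)) 2k≤n)

lemma3p3 : (a n k : ℕ) → 2 ≤ a → 1 ≤ n → 2 ≤ k → 2 * k ≤ n →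
    (v : List (Fin a)) → ¬ Universal {a} n (holesThen k v)
lemma3p3 (suc (suc a)) n k (s≤s (s≤s _)) _ 2≤k 2k≤n v =
  holesThen-not-universal v 2≤k (2≤k⇒2*k≤n⇒2+k≤n 2≤k 2k≤n)
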